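{- Let $G$ be a connected planar embedded graph with a designated face $f_\infty$. Let $K$ and $K'$ be two distinct non-root level components. Then the bounding cycles $X(K)$ and $X(K')$ are edge-disjoint.
   Context: The level $\ell^F(f)$ of a face $f$ is the minimum number of edges on an $f_\infty$-to-$f$ path in the dual $G^*$. For an integer $i \geq 0$, a level-$i$ component is a connected component of the subgraph of $G^*$ induced by the faces of level at least $i$; its level is $i$, and it is non-root if $i \neq 0$. For a level component $K$, $F(K)$ denotes its set of faces (vertices of $G^*$). For a non-root level component $K$, the edges of the dual cut $\delta_{G^*}(F(K))$ (the dual edges with exactly one endpoint in $F(K)$) form a simple cycle in $G$, denoted $X(K)$ and called the bounding cycle of $K$. -}

module Defs where

open import Data.Nat using (ℕ; zero; suc; _+_; _≤_)
open import Data.Fin using (Fin)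
open import Data.Fin.Permutation using (Permutation′; _⟨$⟩ʳ_; _⟨$⟩ˡ_)
open import Data.Product using (Σ; ∃; _×_; _,_)
open import Data.Sum using (_⊎_)
open import Relation.Nullary using (¬_)
open import Relation.Binary.PropositionalEquality using (_≡_)

-- Embedded graphs as combinatorial maps (rotation systems).
-- Darts are Fin d.  α is a fixed-point-free involution (the two darts
-- of an edge), σ is the rotation at the vertices.  Vertices = σ-orbits,
-- edges = α-orbits, faces = φ-orbits where φ = σ ∘ α.

record EmbeddedGraph : Set where
  field
    d     : ℕ
    σ     : Permutation′ d
    α     : Permutation′ d
    α-inv : ∀ x → α ⟨$⟩ʳ (α ⟨$⟩ʳ x) ≡ x
    α-fpf : ∀ x → ¬ (α ⟨$⟩ʳ x ≡ x)

  Dart : Set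
  Dart = Fin d

  φ : Dart → Dart
  φ x = σ ⟨$⟩ʳ (α ⟨$⟩ʳ x)

open EmbeddedGraph public

iter : ∀ {A : Set} → (A → A) → ℕ → A → A
iter f zero    x = x
iter f (suc k) x = f (iter f k x)

SameOrbit : ∀ {A : Set} → (A → A) → A → A → Set
SameOrbit f x y = ∃ λ k → iter f k x ≡ y

module _ (G : EmbeddedGraph) where

  SameFace : Dart G → Dart G → Set
  SameFace = SameOrbit (φ G)

  SameVertex : Dart G → Dart G → Set
  SameVertex = SameOrbit (λ x → σ G ⟨$⟩ʳ x)

  SameEdge : Dart G → Dart G → Set
  SameEdge = SameOrbit (λ x → α G ⟨$⟩ʳ x)

  data Reach : Dart G → Dart G → Set where
    here  : ∀ {x} → Reach x x
    stepσ : ∀ {x y} → Reach x y → Reach x (σ G ⟨$⟩ʳ y)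
    stepσ⁻ : ∀ {x y} → Reach x y → Reach x (σ G ⟨$⟩ˡ y)
    stepα : ∀ {x y} → Reach x y → Reach x (α G ⟨$⟩ʳ y)

  Connected : Set
  Connected = ∀ x y → Reach x y

  OrbitCount : (Dart G → Dart G → Set) → ℕ → Set
  OrbitCount R c =
    Σ (Fin c → Dart G) λ rep →
      (∀ i j → R (rep i) (rep j) → i ≡ j) × (∀ x → ∃ λ i → R (rep i) x)

  Planar : Set
  Planar = ∃ λ V → ∃ λ E → ∃ λ F →
    OrbitCount SameVertex V × OrbitCount SameEdge E × OrbitCount SameFace F
      × (V + F ≡ E + 2)

  -- The dual G*: its vertices are faces; every edge {e , α e} of G is a
  -- dual edge joining the face of e and the face of α e.

  DualEdgeJoins : Dart G → Dart G → Dart G → Set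
  DualEdgeJoins e f g = SameFace e f × SameFace (α G ⟨$⟩ʳ e) g

  DualAdj : Dart G → Dart G → Set
  DualAdj f g = ∃ λ e → DualEdgeJoins e f g

  data DualWalk : ℕ → Dart G → Dart G → Set where
    start : ∀ {f g} → SameFace f g → DualWalk zero f g
    step  : ∀ {k f g h} → DualWalk k f g → DualAdj g h → DualWalk (suc k) f h

  module _ (f∞ : Dart G) where

    IsLevel : Dart G → ℕ → Set
    IsLevel f ℓ = DualWalk ℓ f∞ f × (∀ k → DualWalk k f∞ f → ℓ ≤ k)

    LevelAtLeast : ℕ → Dart G → Set
    LevelAtLeast i f = ∃ λ ℓ → IsLevel f ℓ × i ≤ ℓ

    data InducedWalk (i : ℕ) : Dart G → Dart G → Set where
      start : ∀ {f g} → LevelAtLeast i f → SameFace f g → InducedWalk i f g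
      step  : ∀ {f g h} → InducedWalk i f g → DualAdj g h →
              LevelAtLeast i h → InducedWalk i f h

    -- a level component: its level i and a seed face of level ≥ i;
    -- it is the connected component of the seed in the induced subgraph
    record LevelComponent : Set where
      constructor component
      field
        level   : ℕ
        seed    : Dart G
        seed-ok : LevelAtLeast level seed

    open LevelComponent public

    InF : LevelComponent → Dart G → Set
    InF K f = InducedWalk (level K) (seed K) f

    NonRoot : LevelComponent → Set
    NonRoot K = ¬ (level K ≡ 0)

    SameComponent : LevelComponent → LevelComponent → Set
    SameComponent K K' =
      (level K ≡ level K') × (∀ f → (InF K f → InF K' f) × (InF K' f → InF K f))

    -- the edge {e , α e} lies in the dual cut δ(F(K)), i.e. in X(K):
    -- exactly one of its two incident faces is in F(K)
    InX : LevelComponent → Dart G → Set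
    InX K e = (InF K e × ¬ InF K (α G ⟨$⟩ʳ e))
            ⊎ (¬ InF K e × InF K (α G ⟨$⟩ʳ e))

module Submission where

-- The key fact is the "cut lemma": when a dual
-- edge leaves F(K) from face a to face b, the levels are forced,
--   level(a) = level(K)   and   level(b) + 1 = level(K),
-- because a has level ≥ level(K), b (not in F(K)) has level < level(K), and
-- levels of adjacent faces differ by at most one.  If e leaves K and K' in the
-- same direction, both components then have the same level and share the face
-- a, so they are equal; if it leaves them in opposite directions, the levels
-- of the two faces would each exceed the other by one, which is impossible.

open import Defs
open import Data.Nat using (ℕ; zero; suc; _+_; _*_; _∸_; _≤_; _<_; _≤?_; s≤s)
open import Data.Nat.Properties
  using (+-suc; +-comm; *-suc; m+[n∸m]≡n; n<1+n; ≤-refl; ≤-trans; ≤-antisym; ≰⇒>; m≢1+n+m)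
open import Data.Fin using (Fin; toℕ)
open import Data.Fin.Properties using (pigeonhole)
open import Data.Fin.Permutation using (_⟨$⟩ʳ_; _⟨$⟩ˡ_; inverseˡ)
open import Data.Product using (∃; _×_; _,_; proj₁; proj₂)
open import Data.Sum using (_⊎_; inj₁; inj₂)
open import Data.Empty using (⊥; ⊥-elim)
open import Function.Definitions using (Injective)
open import Relation.Nullary using (¬_; yes; no)
open import Relation.Binary.PropositionalEquality
  using (_≡_; refl; sym; trans; cong; subst; module ≡-Reasoning)

iter-+ : ∀ {A : Set} (f : A → A) m n x → iter f (m + n) x ≡ iter f m (iter f n x)
iter-+ f zero    n x = refl
iter-+ f (suc m) n x = cong f (iter-+ f m n x)

iter-periodic : ∀ {A : Set} (f : A → A) x k → iter f k x ≡ x → ∀ q → iter f (q * k) x ≡ x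
iter-periodic f x k fix zero    = refl
iter-periodic f x k fix (suc q) = begin
  iter f (k + q * k) x      ≡⟨ iter-+ f k (q * k) x ⟩
  iter f k (iter f (q * k) x) ≡⟨ cong (iter f k) (iter-periodic f x k fix q) ⟩
  iter f k x                ≡⟨ fix ⟩
  x                         ∎
  where open ≡-Reasoning

iter-injective : ∀ {A : Set} (f : A → A) → Injective _≡_ _≡_ f →
                 ∀ k {x y} → iter f k x ≡ iter f k y → x ≡ y
iter-injective f inj zero    eq = eq
iter-injective f inj (suc k) eq = iter-injective f inj k (inj eq)

orbit-trans : ∀ {A : Set} (f : A → A) {x y z} → SameOrbit f x y → SameOrbit f y z → SameOrbit f x z
orbit-trans f {x} (k , fk) (m , fm) = m + k , trans (iter-+ f m k x) (trans (cong (iter f m) fk) fm)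

module InjectiveOrbits {d : ℕ} (f : Fin d → Fin d) (inj : Injective _≡_ _≡_ f) where

  -- On a finite set every point of an injective map is periodic: two of the
  -- d + 1 iterates x, f x, …, f^d x coincide, and injectivity cancels the
  -- common prefix.
  periodic : ∀ x → ∃ λ p → iter f (suc p) x ≡ x
  periodic x with pigeonhole (n<1+n d) (λ (j : Fin (suc d)) → iter f (toℕ j) x)
  ... | i , j , i<j , same = toℕ j ∸ suc (toℕ i) , iter-injective f inj (toℕ i) shifted
    where
    open ≡-Reasoning
    gap : ℕ
    gap = suc (toℕ j ∸ suc (toℕ i))
    shifted : iter f (toℕ i) (iter f gap x) ≡ iter f (toℕ i) x
    shifted = begin
      iter f (toℕ i) (iter f gap x) ≡⟨ iter-+ f (toℕ i) gap x ⟨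
      iter f (toℕ i + gap) x        ≡⟨ cong (λ n → iter f n x) (trans (+-suc (toℕ i) _) (m+[n∸m]≡n i<j)) ⟩
      iter f (toℕ j) x              ≡⟨ same ⟨
      iter f (toℕ i) x              ∎

  -- Hence orbits are symmetric: walk on from y until the period closes.
  orbit-sym : ∀ {x y} → SameOrbit f x y → SameOrbit f y x
  orbit-sym {x} {y} (k , fk) with periodic x
  ... | p , fix = k * p , (begin
    iter f (k * p) y            ≡⟨ cong (iter f (k * p)) fk ⟨
    iter f (k * p) (iter f k x) ≡⟨ iter-+ f (k * p) k x ⟨
    iter f (k * p + k) x        ≡⟨ cong (λ n → iter f n x) (trans (+-comm (k * p) k) (sym (*-suc k p))) ⟩
    iter f (k * suc p) x        ≡⟨ iter-periodic f x (suc p) fix k ⟩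
    x                           ∎)
    where open ≡-Reasoning

-- Any inhabited family P over ℕ has a least inhabited index, up to double
-- negation (P need not be decidable).
¬¬-least : (P : ℕ → Set) {k : ℕ} → P k → ¬ ¬ (∃ λ n → P n × (∀ m → P m → n ≤ m))
¬¬-least P {k} = below (suc k) ≤-refl
  where
  below : ∀ bound {k} → k < bound → P k → ¬ ¬ (∃ λ n → P n × (∀ m → P m → n ≤ m))
  below (suc bound) {k} (s≤s k≤bound) pk noLeast = noLeast (k , pk , k-least)
    where
    k-least : ∀ m → P m → k ≤ m
    k-least m pm with k ≤? m
    ... | yes k≤m = k≤m
    ... | no  k≰m = ⊥-elim (below bound (≤-trans (≰⇒> k≰m) k≤bound) pm noLeast)

module Dual (G : EmbeddedGraph) where

  φ-injective : Injective _≡_ _≡_ (φ G)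
  φ-injective {x} {y} eq = begin
    x                       ≡⟨ α-inv G x ⟨
    α G ⟨$⟩ʳ (α G ⟨$⟩ʳ x)   ≡⟨ cong (α G ⟨$⟩ʳ_) αx≡αy ⟩
    α G ⟨$⟩ʳ (α G ⟨$⟩ʳ y)   ≡⟨ α-inv G y ⟩
    y                       ∎
    where
    open ≡-Reasoning
    αx≡αy : α G ⟨$⟩ʳ x ≡ α G ⟨$⟩ʳ y
    αx≡αy = trans (sym (inverseˡ (σ G))) (trans (cong (σ G ⟨$⟩ˡ_) eq) (inverseˡ (σ G)))

  face-refl : ∀ {x} → SameFace G x x
  face-refl = 0 , refl

  face-sym : ∀ {x y} → SameFace G x y → SameFace G y x
  face-sym = InjectiveOrbits.orbit-sym (φ G) φ-injective

  face-trans : ∀ {x y z} → SameFace G x y → SameFace G y z → SameFace G x z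
  face-trans = orbit-trans (φ G)

  adj-face : ∀ {f g h} → DualAdj G f g → SameFace G g h → DualAdj G f h
  adj-face (e , inf , ing) g~h = e , inf , face-trans ing g~h

  adj-sym : ∀ {f g} → DualAdj G f g → DualAdj G g f
  adj-sym (e , inf , ing) = α G ⟨$⟩ʳ e , ing , subst (λ x → SameFace G x _) (sym (α-inv G e)) inf

  edge-adj : ∀ e → DualAdj G e (α G ⟨$⟩ʳ e)
  edge-adj e = e , face-refl , face-refl

  walk-face : ∀ {k f g h} → DualWalk G k f g → SameFace G g h → DualWalk G k f h
  walk-face (start f~g) g~h = start (face-trans f~g g~h)
  walk-face (step w a)  g~h = step w (adj-face a g~h)

module Levels (G : EmbeddedGraph) (f∞ : Dart G) where

  open Dual G

  level-unique : ∀ {f ℓ ℓ'} → IsLevel G f∞ f ℓ → IsLevel G f∞ f ℓ' → ℓ ≡ ℓ'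
  level-unique (w , least) (w' , least') = ≤-antisym (least _ w') (least' _ w)

  level-exists : ∀ {k f} → DualWalk G k f∞ f → ¬ ¬ (∃ λ ℓ → IsLevel G f∞ f ℓ)
  level-exists = ¬¬-least (λ k → DualWalk G k f∞ _)

  level-face : ∀ {f g ℓ} → IsLevel G f∞ f ℓ → SameFace G f g → IsLevel G f∞ g ℓ
  level-face (w , least) f~g = walk-face w f~g , λ k w' → least k (walk-face w' (face-sym f~g))

  atLeast-face : ∀ {i f g} → LevelAtLeast G f∞ i f → SameFace G f g → LevelAtLeast G f∞ i g
  atLeast-face (ℓ , lvl , i≤ℓ) f~g = ℓ , level-face lvl f~g , i≤ℓ

  level-adj : ∀ {f g ℓf ℓg} → DualAdj G f g → IsLevel G f∞ f ℓf → IsLevel G f∞ g ℓg → ℓg ≤ suc ℓf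
  level-adj adj (w , _) (_ , least) = least _ (step w adj)

  induced-end : ∀ {i f g} → InducedWalk G f∞ i f g → LevelAtLeast G f∞ i g
  induced-end (start ok f~g) = atLeast-face ok f~g
  induced-end (step _ _ ok)  = ok

  induced-face : ∀ {i f g h} → InducedWalk G f∞ i f g → SameFace G g h → InducedWalk G f∞ i f h
  induced-face (start ok f~g) g~h = start ok (face-trans f~g g~h)
  induced-face (step w a ok)  g~h = step w (adj-face a g~h) (atLeast-face ok g~h)

  induced-trans : ∀ {i f g h} → InducedWalk G f∞ i f g → InducedWalk G f∞ i g h → InducedWalk G f∞ i f h
  induced-trans w (start _ g~h) = induced-face w g~h
  induced-trans w (step w' a ok) = step (induced-trans w w') a ok

  induced-sym : ∀ {i f g} → InducedWalk G f∞ i f g → InducedWalk G f∞ i g f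
  induced-sym (start ok f~g) = start (atLeast-face ok f~g) (face-sym f~g)
  induced-sym (step w a ok) =
    induced-trans (step (start ok face-refl) (adj-sym a) (induced-end w)) (induced-sym w)

  shared-face : ∀ K K' {f} → level K ≡ level K' → InF G f∞ K f → InF G f∞ K' f → SameComponent G f∞ K K'
  shared-face (component i s _) (component .i s' _) refl inK inK' =
    refl , λ g → (λ w → induced-trans inK' (induced-trans (induced-sym inK) w))
               , (λ w → induced-trans inK (induced-trans (induced-sym inK') w))

  Leaves : LevelComponent G f∞ → Dart G → Dart G → Set
  Leaves K a b = InF G f∞ K a × ¬ InF G f∞ K b

  Crosses : LevelComponent G f∞ → Dart G → Dart G → Set
  Crosses K a b = Leaves K a b ⊎ Leaves K b a

  leaving-levels : ∀ K {a b ℓa ℓb} → DualAdj G a b → IsLevel G f∞ a ℓa → IsLevel G f∞ b ℓb →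
                   Leaves K a b → (ℓa ≡ level K) × (suc ℓb ≡ level K)
  leaving-levels K {a} {b} {ℓa} {ℓb} adj lvl-a lvl-b (a∈K , b∉K) =
    ≤-antisym (≤-trans ℓa≤1+ℓb 1+ℓb≤i) i≤ℓa , ≤-antisym 1+ℓb≤i (≤-trans i≤ℓa ℓa≤1+ℓb)
    where
    i≤ℓa : level K ≤ ℓa
    i≤ℓa with induced-end a∈K
    ... | ℓ , lvl , i≤ℓ = subst (level K ≤_) (level-unique lvl lvl-a) i≤ℓ
    1+ℓb≤i : suc ℓb ≤ level K
    1+ℓb≤i with level K ≤? ℓb
    ... | yes i≤ℓb = ⊥-elim (b∉K (step a∈K adj (ℓb , lvl-b , i≤ℓb)))
    ... | no  i≰ℓb = ≰⇒> i≰ℓb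
    ℓa≤1+ℓb : ℓa ≤ suc ℓb
    ℓa≤1+ℓb = level-adj (adj-sym adj) lvl-b lvl-a

  -- An edge leaving K and K' in the same direction forces equal levels and a
  -- shared face, hence K = K'.
  leaving-both : ∀ K K' {a b ℓa ℓb} → DualAdj G a b → IsLevel G f∞ a ℓa → IsLevel G f∞ b ℓb →
                 Leaves K a b → Leaves K' a b → SameComponent G f∞ K K'
  leaving-both K K' adj lvl-a lvl-b out out' =
    shared-face K K' (trans (sym (proj₁ (leaving-levels K adj lvl-a lvl-b out)))
                            (proj₁ (leaving-levels K' adj lvl-a lvl-b out')))
                     (proj₁ out) (proj₁ out')

  -- No edge leaves K from a to b and K' from b to a: the level of each end
  -- would exceed the level of the other by one.
  leaving-opposite : ∀ K K' {a b ℓa ℓb} → DualAdj G a b → IsLevel G f∞ a ℓa → IsLevel G f∞ b ℓb →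
                     Leaves K a b → Leaves K' b a → ⊥
  leaving-opposite K K' {ℓa = ℓa} {ℓb} adj lvl-a lvl-b out out' = m≢1+n+m ℓa ℓa≡2+ℓa
    where
    open ≡-Reasoning
    atK : (ℓa ≡ level K) × (suc ℓb ≡ level K)
    atK  = leaving-levels K adj lvl-a lvl-b out
    atK' : (ℓb ≡ level K') × (suc ℓa ≡ level K')
    atK' = leaving-levels K' (adj-sym adj) lvl-b lvl-a out'
    ℓa≡2+ℓa : ℓa ≡ suc (suc ℓa)
    ℓa≡2+ℓa = begin
      ℓa           ≡⟨ proj₁ atK ⟩
      level K      ≡⟨ proj₂ atK ⟨
      suc ℓb       ≡⟨ cong suc (proj₁ atK') ⟩
      suc (level K') ≡⟨ cong suc (proj₂ atK') ⟨
      suc (suc ℓa) ∎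

  crossing-both : ∀ K K' {a b ℓa ℓb} → DualAdj G a b → IsLevel G f∞ a ℓa → IsLevel G f∞ b ℓb →
                  Crosses K a b → Crosses K' a b → SameComponent G f∞ K K'
  crossing-both K K' adj la lb (inj₁ out) (inj₁ out') = leaving-both K K' adj la lb out out'
  crossing-both K K' adj la lb (inj₂ out) (inj₂ out') = leaving-both K K' (adj-sym adj) lb la out out'
  crossing-both K K' adj la lb (inj₁ out) (inj₂ out') = ⊥-elim (leaving-opposite K K' adj la lb out out')
  crossing-both K K' adj la lb (inj₂ out) (inj₁ out') = ⊥-elim (leaving-opposite K' K adj la lb out' out)

  InX-crosses : ∀ K {e} → InX G f∞ K e → Crosses K e (α G ⟨$⟩ʳ e)
  InX-crosses K (inj₁ out)         = inj₁ out
  InX-crosses K (inj₂ (e∉K , α∈K)) = inj₂ (α∈K , e∉K)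

  reachable : ∀ K {f} → InF G f∞ K f → ∃ λ k → DualWalk G k f∞ f
  reachable K f∈K with induced-end f∈K
  ... | ℓ , (w , _) , _ = ℓ , w

  cut-reachable : ∀ K {a b} → DualAdj G a b → Crosses K a b → ∃ λ k → DualWalk G k f∞ a
  cut-reachable K adj (inj₁ (a∈K , _)) = reachable K a∈K
  cut-reachable K adj (inj₂ (b∈K , _)) with reachable K b∈K
  ... | k , w = suc k , step w (adj-sym adj)

-- Lemma 11.
lemma11 : (G : EmbeddedGraph) → Connected G → Planar G → (f∞ : Dart G) →
          (K K' : LevelComponent G f∞) → NonRoot G f∞ K → NonRoot G f∞ K' →
          ¬ SameComponent G f∞ K K' →
          ¬ (∃ λ e → InX G f∞ K e × InX G f∞ K' e)
lemma11 G _ _ f∞ K K' _ _ distinct (e , e∈X , e∈X') =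
  level-exists (proj₂ (cut-reachable K edge crossK)) λ where
    (ℓ , lvl) → level-exists (step (proj₁ lvl) edge) λ where
      (ℓ' , lvl') → distinct (crossing-both K K' edge lvl lvl' crossK (InX-crosses K' e∈X'))
  where
  open Dual G using (edge-adj)
  open Levels G f∞
  edge : DualAdj G e (α G ⟨$⟩ʳ e)
  edge = edge-adj e
  crossK : Crosses K e (α G ⟨$⟩ʳ e)
  crossK = InX-crosses K e∈X
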